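{- Let $a,b$ be relatively prime positive integers, $n\ge1$, and let $\pi$ be an $(a,b)$-Dyck path of size $n$. Let $\theta_h(\pi)=(p_1,\dots,p_b)$ and, for $i\in[1,b]$, let $\theta_v(p_i)=(r_{i,1},\dots,r_{i,a})$. Then $r_{i,j}\le r_{i+1,j}$ for all $i\in[1,b-1]$, $j\in[1,a]$, and $r_{i,j+1}\le r_{i,j}$ for all $i\in[1,b]$, $j\in[1,a-1]$.
   Context: An $(a,b)$-Dyck path of size $n$ is a lattice path from $(0,0)$ to $(bn,an)$ with unit steps $N=(0,1)$, $E=(1,0)$ never going below $y=ax/b$. Step sequence of a path with $A$ north steps: $(u_1,\dots,u_A)$, $u_k$ the $x$-coordinate of the $k$-th north step. Height sequence of a path with $B$ east steps: $(h_1,\dots,h_B)$, $h_k$ the $y$-coordinate of the $k$-th east step. $\theta_h$: for a path from $(0,0)$ to $(bn,m)$ with height sequence $(h_1,\dots,h_{bn})$, it returns paths $p_1,\dots,p_b$ from $(0,0)$ to $(n,m)$, $p_i$ having height sequence $(h_{(k-1)b+i})_{k=1}^n$. $\theta_v$: for a path from $(0,0)$ to $(m,an)$ with step sequence $(u_1,\dots,u_{an})$, it returns paths $q_1,\dots,q_a$ from $(0,0)$ to $(m,n)$, $q_j$ having step sequence $(u_{(k-1)a+j})_{k=1}^n$. Thus each $r_{i,j}$ is a lattice path from $(0,0)$ to $(n,n)$. For two lattice paths $r,s$ from $(0,0)$ to $(n,n)$, $r\le s$ means $s$ is weakly above $r$, i.e. the Young diagram bounded by $s$, the line $x=0$ and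 the line $y=n$ is contained in that of $r$ (equivalently, the step sequence of $s$ is entrywise at most that of $r$). -}

module Defs where

open import Data.Nat using (ℕ; zero; suc; _+_; _*_; _≤_)
open import Data.List using (List; []; _∷_; map; upTo; _++_; replicate)
open import Data.List.Relation.Binary.Pointwise using (Pointwise)
open import Data.Product using (_×_)
open import Relation.Binary.PropositionalEquality using (_≡_)

-- Unit steps of a lattice path: N = (0,1), E = (1,0).
data Step : Set where
  N E : Step

Path : Set
Path = List Step

#E : Path → ℕ
#E []       = 0
#E (N ∷ p)  = #E p
#E (E ∷ p)  = suc (#E p)

#N : Path → ℕ
#N []       = 0
#N (N ∷ p)  = suc (#N p)
#N (E ∷ p)  = #N p

-- every lattice point (x,y) visited, when the path starts at (x,y),
-- lies weakly above the line y = a x / b, i.e.  a * x ≤ b * y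
AboveFrom : ℕ → ℕ → ℕ → ℕ → Path → Set
AboveFrom a b x y []       = a * x ≤ b * y
AboveFrom a b x y (N ∷ p)  = (a * x ≤ b * y) × AboveFrom a b x (suc y) p
AboveFrom a b x y (E ∷ p)  = (a * x ≤ b * y) × AboveFrom a b (suc x) y p

IsDyck : ℕ → ℕ → ℕ → Path → Set
IsDyck a b n p = (#E p ≡ b * n) × (#N p ≡ a * n) × AboveFrom a b 0 0 p

stepsFrom : ℕ → Path → List ℕ
stepsFrom x []       = []
stepsFrom x (N ∷ p)  = x ∷ stepsFrom x p
stepsFrom x (E ∷ p)  = stepsFrom (suc x) p

stepSeq : Path → List ℕ
stepSeq = stepsFrom 0

heightsFrom : ℕ → Path → List ℕ
heightsFrom y []       = []
heightsFrom y (N ∷ p)  = heightsFrom (suc y) p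
heightsFrom y (E ∷ p)  = y ∷ heightsFrom y p

heightSeq : Path → List ℕ
heightSeq = heightsFrom 0

_∸'_ : ℕ → ℕ → ℕ
m      ∸' zero   = m
zero   ∸' suc n  = zero
suc m  ∸' suc n  = m ∸' n

-- the path from (0,0) to (#hs, m) with height sequence hs (weakly increasing, ≤ m)
fromHeightsAt : ℕ → ℕ → List ℕ → Path
fromHeightsAt y m []        = replicate (m ∸' y) N
fromHeightsAt y m (h ∷ hs)  = replicate (h ∸' y) N ++ (E ∷ fromHeightsAt h m hs)

fromHeights : ℕ → List ℕ → Path
fromHeights m hs = fromHeightsAt 0 m hs

-- the path from (0,0) to (m, #us) with step sequence us (weakly increasing, ≤ m)
fromStepsAt : ℕ → ℕ → List ℕ → Path
fromStepsAt x m []        = replicate (m ∸' x) E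
fromStepsAt x m (u ∷ us)  = replicate (u ∸' x) E ++ (N ∷ fromStepsAt u m us)

fromSteps : ℕ → List ℕ → Path
fromSteps m us = fromStepsAt 0 m us

-- k-th entry (0-indexed) of a list (0 if out of range; never used out of range)
nth : List ℕ → ℕ → ℕ
nth []       k        = 0
nth (x ∷ xs) zero     = x
nth (x ∷ xs) (suc k)  = nth xs k

-- θ_h: for a path π from (0,0) to (bn,m), the i-th path (0-indexed, i < b)
-- is the path to (n,m) with height sequence (h_{kb+i})_{k=0}^{n-1}
θh : (b n m : ℕ) → Path → ℕ → Path
θh b n m π i = fromHeights m (map (λ k → nth (heightSeq π) (k * b + i)) (upTo n))

-- θ_v: for a path from (0,0) to (m,an), the j-th path (0-indexed, j < a)
-- is the path to (m,n) with step sequence (u_{ka+j})_{k=0}^{n-1}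
θv : (a n m : ℕ) → Path → ℕ → Path
θv a n m π j = fromSteps m (map (λ k → nth (stepSeq π) (k * a + j)) (upTo n))

-- r ≤ s : s weakly above r, i.e. step sequence of s entrywise ≤ that of r
_≤P_ : Path → Path → Set
r ≤P s = Pointwise _≤_ (stepSeq s) (stepSeq r)

-- The height sequence of π is weakly increasing, so the height sequence of p_i, being the
-- stride (h_{kb+i})_k, is weakly increasing and grows entrywise with i. The step sequence of
-- a path is conjugate to its height sequence: its t-th entry is the number of heights ≤ t.
-- Hence the step sequence of r_{i,j} is (#{heights of p_i that are ≤ ka+j})_k, which shrinks
-- when the heights grow (i ↦ i+1) and grows with the threshold (j ↦ j+1).
module Submission where

open import Defs
open import Data.Nat using (ℕ; zero; suc; _+_; _∸_; _*_; _≤_; _<_; z≤n; s≤s; z<s; s<s; _≤?_; _<?_)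
open import Data.Nat.Properties
open import Data.Nat.Coprimality using (Coprime)
open import Data.List using (List; []; _∷_; _++_; map; length; replicate; applyUpTo; upTo)
open import Data.List.Properties using (map-upTo; ++-identityʳ)
open import Data.List.Relation.Binary.Pointwise using (Pointwise; []; _∷_; Pointwise-≡⇒≡)
open import Data.Product using (_×_; _,_)
open import Function using (_∘_)
open import Relation.Binary.PropositionalEquality
open import Relation.Nullary using (yes; no)
open import Relation.Nullary.Negation using (contradiction)

data SortedFrom : ℕ → List ℕ → Set where
  []  : ∀ {y} → SortedFrom y []
  _∷_ : ∀ {y h hs} → y ≤ h → SortedFrom h hs → SortedFrom y (h ∷ hs)

SortedFrom-weaken : ∀ {x y xs} → x ≤ y → SortedFrom y xs → SortedFrom x xs
SortedFrom-weaken x≤y []          = []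
SortedFrom-weaken x≤y (y≤h ∷ hs↑) = ≤-trans x≤y y≤h ∷ hs↑

SortedFrom⇒≤nth : ∀ {y xs} j → SortedFrom y xs → j < length xs → y ≤ nth xs j
SortedFrom⇒≤nth zero    (y≤h ∷ _)   _           = y≤h
SortedFrom⇒≤nth (suc j) (y≤h ∷ hs↑) (s≤s j<len) = ≤-trans y≤h (SortedFrom⇒≤nth j hs↑ j<len)

nth-mono-≤ : ∀ {y xs} i j → SortedFrom y xs → i ≤ j → j < length xs → nth xs i ≤ nth xs j
nth-mono-≤ zero    j       (_ ∷ hs↑) _         j<len       = SortedFrom⇒≤nth j (≤-refl ∷ hs↑) j<len
nth-mono-≤ (suc i) (suc j) (_ ∷ hs↑) (s≤s i≤j) (s≤s j<len) = nth-mono-≤ i j hs↑ i≤j j<len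

nth-replicate-++ˡ : ∀ k (x : ℕ) xs t → t < k → nth (replicate k x ++ xs) t ≡ x
nth-replicate-++ˡ (suc k) x xs zero    _         = refl
nth-replicate-++ˡ (suc k) x xs (suc t) (s≤s t<k) = nth-replicate-++ˡ k x xs t t<k

nth-replicate-++ʳ : ∀ k (x : ℕ) xs t → nth (replicate k x ++ xs) (k + t) ≡ nth xs t
nth-replicate-++ʳ zero    x xs t = refl
nth-replicate-++ʳ (suc k) x xs t = nth-replicate-++ʳ k x xs t

map-upTo-pointwise : ∀ {R : ℕ → ℕ → Set} (f g : ℕ → ℕ) n →
  (∀ k → k < n → R (f k) (g k)) → Pointwise R (map f (upTo n)) (map g (upTo n))
map-upTo-pointwise {R} f g n fRg rewrite map-upTo f n | map-upTo g n = applyUpTo-pointwise f g n fRg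
  where
  applyUpTo-pointwise : ∀ (f g : ℕ → ℕ) n →
    (∀ k → k < n → R (f k) (g k)) → Pointwise R (applyUpTo f n) (applyUpTo g n)
  applyUpTo-pointwise f g zero    _   = []
  applyUpTo-pointwise f g (suc n) fRg =
    fRg 0 z<s ∷ applyUpTo-pointwise (f ∘ suc) (g ∘ suc) n (λ k → fRg (suc k) ∘ s<s)

map-upTo-cong : ∀ (f g : ℕ → ℕ) n → (∀ k → k < n → f k ≡ g k) → map f (upTo n) ≡ map g (upTo n)
map-upTo-cong f g n f≡g = Pointwise-≡⇒≡ (map-upTo-pointwise f g n f≡g)

map-upTo-sorted : ∀ (f : ℕ → ℕ) n → (∀ k → suc k < n → f k ≤ f (suc k)) →
  SortedFrom 0 (map f (upTo n))
map-upTo-sorted f n f↑ rewrite map-upTo f n = applyUpTo-sorted f n z≤n f↑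
  where
  applyUpTo-sorted : ∀ {y} (f : ℕ → ℕ) n → y ≤ f 0 →
    (∀ k → suc k < n → f k ≤ f (suc k)) → SortedFrom y (applyUpTo f n)
  applyUpTo-sorted f zero          _    _  = []
  applyUpTo-sorted f (suc zero)    y≤f0 _  = y≤f0 ∷ []
  applyUpTo-sorted f (suc (suc n)) y≤f0 f↑ =
    y≤f0 ∷ applyUpTo-sorted (f ∘ suc) (suc n) (f↑ 0 (s<s z<s)) (λ k → f↑ (suc k) ∘ s<s)

count≤ : ℕ → List ℕ → ℕ
count≤ t []       = 0
count≤ t (g ∷ gs) with g ≤? t
... | yes _ = suc (count≤ t gs)
... | no  _ = count≤ t gs

count≤-head : ∀ {g t} gs → g ≤ t → count≤ t (g ∷ gs) ≡ suc (count≤ t gs)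
count≤-head {g} {t} gs g≤t with g ≤? t
... | yes _  = refl
... | no g≰t = contradiction g≤t g≰t

count≤-below : ∀ {g t gs} → SortedFrom g gs → t < g → count≤ t gs ≡ 0
count≤-below                  []          _   = refl
count≤-below {t = t} {h ∷ hs} (g≤h ∷ hs↑) t<g with h ≤? t
... | yes h≤t = contradiction (≤-trans g≤h h≤t) (<⇒≱ t<g)
... | no  _   = count≤-below hs↑ (<-≤-trans t<g g≤h)

count≤-monoˡ-≤ : ∀ {s t} gs → s ≤ t → count≤ s gs ≤ count≤ t gs
count≤-monoˡ-≤         []       _   = z≤n
count≤-monoˡ-≤ {s} {t} (g ∷ gs) s≤t with g ≤? s | g ≤? t
... | yes _   | yes _   = s≤s (count≤-monoˡ-≤ gs s≤t)
... | yes g≤s | no  g≰t = contradiction (≤-trans g≤s s≤t) g≰t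
... | no  _   | yes _   = m≤n⇒m≤1+n (count≤-monoˡ-≤ gs s≤t)
... | no  _   | no  _   = count≤-monoˡ-≤ gs s≤t

count≤-antitone : ∀ {t gs hs} → Pointwise _≤_ gs hs → count≤ t hs ≤ count≤ t gs
count≤-antitone                      []             = z≤n
count≤-antitone {t} {g ∷ _} {h ∷ _} (g≤h ∷ gs≤hs) with g ≤? t | h ≤? t
... | yes _   | yes _   = s≤s (count≤-antitone gs≤hs)
... | no  g≰t | yes h≤t = contradiction (≤-trans g≤h h≤t) g≰t
... | yes _   | no  _   = m≤n⇒m≤1+n (count≤-antitone gs≤hs)
... | no  _   | no  _   = count≤-antitone gs≤hs

∸'≡∸ : ∀ m n → m ∸' n ≡ m ∸ n
∸'≡∸ m       zero    = refl
∸'≡∸ zero    (suc n) = refl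
∸'≡∸ (suc m) (suc n) = ∸'≡∸ m n

m+[n∸'m]≡n : ∀ {m n} → m ≤ n → m + (n ∸' m) ≡ n
m+[n∸'m]≡n {m} {n} m≤n = trans (cong (m +_) (∸'≡∸ n m)) (m+[n∸m]≡n m≤n)

m∸'n+n≡m : ∀ {m n} → n ≤ m → (m ∸' n) + n ≡ m
m∸'n+n≡m {m} {n} n≤m = trans (cong (_+ n) (∸'≡∸ m n)) (m∸n+n≡m n≤m)

m+n<o⇒n<o∸'m : ∀ m {n o} → m + n < o → n < o ∸' m
m+n<o⇒n<o∸'m m {n} {o} m+n<o = subst (n <_) (sym (∸'≡∸ o m))
  (m+n≤o⇒m≤o∸n (suc n) (subst (_≤ o) (cong suc (+-comm m n)) m+n<o))

heightsFrom-sorted : ∀ y p → SortedFrom y (heightsFrom y p)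
heightsFrom-sorted y []      = []
heightsFrom-sorted y (N ∷ p) = SortedFrom-weaken (n≤1+n y) (heightsFrom-sorted (suc y) p)
heightsFrom-sorted y (E ∷ p) = ≤-refl ∷ heightsFrom-sorted y p

length-heightsFrom : ∀ y p → length (heightsFrom y p) ≡ #E p
length-heightsFrom y []      = refl
length-heightsFrom y (N ∷ p) = length-heightsFrom (suc y) p
length-heightsFrom y (E ∷ p) = cong suc (length-heightsFrom y p)

stepsFrom-replicateN : ∀ x k p → stepsFrom x (replicate k N ++ p) ≡ replicate k x ++ stepsFrom x p
stepsFrom-replicateN x zero    p = refl
stepsFrom-replicateN x (suc k) p = cong (x ∷_) (stepsFrom-replicateN x k p)

stepsFrom-replicateE : ∀ x k p → stepsFrom x (replicate k E ++ p) ≡ stepsFrom (k + x) p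
stepsFrom-replicateE x zero    p = refl
stepsFrom-replicateE x (suc k) p =
  trans (stepsFrom-replicateE (suc x) k p) (cong (λ z → stepsFrom z p) (+-suc k x))

stepsFrom-fromHeightsAt : ∀ x y m gs → SortedFrom y gs → ∀ t → y + t < m →
  nth (stepsFrom x (fromHeightsAt y m gs)) t ≡ x + count≤ (y + t) gs
stepsFrom-fromHeightsAt x y m [] _ t y+t<m = begin
  nth (stepsFrom x (replicate k N)) t        ≡⟨ cong (λ p → nth (stepsFrom x p) t) (sym (++-identityʳ (replicate k N))) ⟩
  nth (stepsFrom x (replicate k N ++ [])) t  ≡⟨ cong (λ xs → nth xs t) (stepsFrom-replicateN x k []) ⟩
  nth (replicate k x ++ []) t                ≡⟨ nth-replicate-++ˡ k x [] t (m+n<o⇒n<o∸'m y y+t<m) ⟩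
  x                                          ≡⟨ sym (+-identityʳ x) ⟩
  x + 0                                      ∎
  where
  open ≡-Reasoning
  k = m ∸' y
stepsFrom-fromHeightsAt x y m (g ∷ gs) (y≤g ∷ gs↑) t y+t<m
  rewrite stepsFrom-replicateN x (g ∸' y) (E ∷ fromHeightsAt g m gs)
  with t <? g ∸' y
... | yes t<k = begin
  nth (replicate (g ∸' y) x ++ _) t  ≡⟨ nth-replicate-++ˡ (g ∸' y) x _ t t<k ⟩
  x                                  ≡⟨ sym (+-identityʳ x) ⟩
  x + 0                              ≡⟨ cong (x +_) (sym (count≤-below (≤-refl ∷ gs↑) y+t<g)) ⟩
  x + count≤ (y + t) (g ∷ gs)        ∎
  where
  open ≡-Reasoning
  y+t<g : y + t < g
  y+t<g = subst (y + t <_) (m+[n∸'m]≡n y≤g) (+-monoʳ-< y t<k)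
... | no t≮k with m≤n⇒∃[o]m+o≡n (≮⇒≥ t≮k)
...   | t' , refl = begin
  nth (replicate (g ∸' y) x ++ stepsFrom (suc x) rest) (g ∸' y + t')  ≡⟨ nth-replicate-++ʳ (g ∸' y) x _ t' ⟩
  nth (stepsFrom (suc x) rest) t'                                      ≡⟨ stepsFrom-fromHeightsAt (suc x) g m gs gs↑ t' g+t'<m ⟩
  suc x + count≤ (g + t') gs                                           ≡⟨ sym (+-suc x _) ⟩
  x + suc (count≤ (g + t') gs)                                         ≡⟨ cong (x +_) (sym (count≤-head gs (m≤m+n g t'))) ⟩
  x + count≤ (g + t') (g ∷ gs)                                         ≡⟨ cong (λ s → x + count≤ s (g ∷ gs)) (sym y+t≡g+t') ⟩
  x + count≤ (y + (g ∸' y + t')) (g ∷ gs)                              ∎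
  where
  open ≡-Reasoning
  rest = fromHeightsAt g m gs
  y+t≡g+t' : y + (g ∸' y + t') ≡ g + t'
  y+t≡g+t' = trans (sym (+-assoc y (g ∸' y) t')) (cong (_+ t') (m+[n∸'m]≡n y≤g))
  g+t'<m : g + t' < m
  g+t'<m = subst (_< m) y+t≡g+t' y+t<m

stepsFrom-fromStepsAt : ∀ x m us → SortedFrom x us → stepsFrom x (fromStepsAt x m us) ≡ us
stepsFrom-fromStepsAt x m [] [] =
  trans (cong (stepsFrom x) (sym (++-identityʳ (replicate (m ∸' x) E)))) (stepsFrom-replicateE x (m ∸' x) [])
stepsFrom-fromStepsAt x m (u ∷ us) (x≤u ∷ us↑) = begin
  stepsFrom x (replicate (u ∸' x) E ++ N ∷ fromStepsAt u m us)  ≡⟨ stepsFrom-replicateE x (u ∸' x) _ ⟩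
  stepsFrom (u ∸' x + x) (N ∷ fromStepsAt u m us)               ≡⟨ cong (λ z → stepsFrom z (N ∷ fromStepsAt u m us)) (m∸'n+n≡m x≤u) ⟩
  u ∷ stepsFrom u (fromStepsAt u m us)                          ≡⟨ cong (u ∷_) (stepsFrom-fromStepsAt u m us us↑) ⟩
  u ∷ us                                                        ∎
  where open ≡-Reasoning

-- θh b n m π i is definitionally fromHeights m (stride b n (heightSeq π) i); θv likewise.
stride : ℕ → ℕ → List ℕ → ℕ → List ℕ
stride b n xs i = map (λ k → nth xs (k * b + i)) (upTo n)

stride-index< : ∀ {b n i k} → k < n → i < b → k * b + i < b * n
stride-index< {b} {n} {i} {k} k<n i<b = begin-strict
  k * b + i  <⟨ +-monoʳ-< (k * b) i<b ⟩
  k * b + b  ≡⟨ +-comm (k * b) b ⟩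
  suc k * b  ≤⟨ *-monoˡ-≤ b k<n ⟩
  n * b      ≡⟨ *-comm n b ⟩
  b * n      ∎
  where open ≤-Reasoning

stride-sorted : ∀ {b n xs i} → SortedFrom 0 xs → length xs ≡ b * n → i < b →
  SortedFrom 0 (stride b n xs i)
stride-sorted {b} {n} {xs} {i} xs↑ |xs| i<b = map-upTo-sorted _ n λ k k+1<n →
  nth-mono-≤ (k * b + i) (suc k * b + i) xs↑ (+-monoˡ-≤ i (m≤n+m (k * b) b))
    (subst (suc k * b + i <_) (sym |xs|) (stride-index< k+1<n i<b))

stride-mono : ∀ {b n xs i} → SortedFrom 0 xs → length xs ≡ b * n → suc i < b →
  Pointwise _≤_ (stride b n xs i) (stride b n xs (suc i))
stride-mono {b} {n} {xs} {i} xs↑ |xs| i+1<b = map-upTo-pointwise _ _ n λ k k<n →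
  nth-mono-≤ (k * b + i) (k * b + suc i) xs↑ (+-monoʳ-≤ (k * b) (n≤1+n i))
    (subst (k * b + suc i <_) (sym |xs|) (stride-index< k<n i+1<b))

countStride : ℕ → ℕ → ℕ → List ℕ → List ℕ
countStride a n j gs = map (λ k → count≤ (k * a + j) gs) (upTo n)

stepSeq-θv-fromHeights : ∀ {a n j gs} → SortedFrom 0 gs → j < a →
  stepSeq (θv a n n (fromHeights (a * n) gs) j) ≡ countStride a n j gs
stepSeq-θv-fromHeights {a} {n} {j} {gs} gs↑ j<a = begin
  stepSeq (fromSteps n (stride a n (stepSeq (fromHeights (a * n) gs)) j))
    ≡⟨ cong (stepSeq ∘ fromSteps n) (map-upTo-cong _ _ n λ k k<n →
         stepsFrom-fromHeightsAt 0 0 (a * n) gs gs↑ (k * a + j) (stride-index< k<n j<a)) ⟩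
  stepSeq (fromSteps n (countStride a n j gs))
    ≡⟨ stepsFrom-fromStepsAt 0 n _ (map-upTo-sorted _ n λ k _ →
         count≤-monoˡ-≤ gs (+-monoˡ-≤ j (m≤n+m (k * a) a))) ⟩
  countStride a n j gs
    ∎
  where open ≡-Reasoning

mainTheorem8 : (a b n : ℕ) → 0 < a → 0 < b → Coprime a b → 1 ≤ n →
    (π : Path) → IsDyck a b n π →
    let r : ℕ → ℕ → Path
        r i j = θv a n n (θh b n (a * n) π i) j
    in ((i j : ℕ) → suc i < b → j < a → r i j ≤P r (suc i) j)
     × ((i j : ℕ) → i < b → suc j < a → r i (suc j) ≤P r i j)
mainTheorem8 a b n _ _ _ _ π (#E≡bn , _ , _) = increasing-in-i , decreasing-in-j
  where
  H : List ℕ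
  H = heightSeq π
  H↑ : SortedFrom 0 H
  H↑ = heightsFrom-sorted 0 π
  |H| : length H ≡ b * n
  |H| = trans (length-heightsFrom 0 π) #E≡bn
  r : ℕ → ℕ → Path
  r i j = θv a n n (θh b n (a * n) π i) j
  C : ℕ → ℕ → List ℕ
  C i j = countStride a n j (stride b n H i)
  stepSeq-r : ∀ {i j} → i < b → j < a → stepSeq (r i j) ≡ C i j
  stepSeq-r i<b j<a = stepSeq-θv-fromHeights (stride-sorted H↑ |H| i<b) j<a
  ≤P-from-C : ∀ i j i' j' → i < b → j < a → i' < b → j' < a → Pointwise _≤_ (C i' j') (C i j) →
    r i j ≤P r i' j'
  ≤P-from-C i j i' j' i<b j<a i'<b j'<a =
    subst₂ (Pointwise _≤_) (sym (stepSeq-r i'<b j'<a)) (sym (stepSeq-r i<b j<a))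
  increasing-in-i : (i j : ℕ) → suc i < b → j < a → r i j ≤P r (suc i) j
  increasing-in-i i j i+1<b j<a =
    ≤P-from-C i j (suc i) j (<-trans (n<1+n i) i+1<b) j<a i+1<b j<a
      (map-upTo-pointwise _ _ n λ _ _ → count≤-antitone (stride-mono H↑ |H| i+1<b))
  decreasing-in-j : (i j : ℕ) → i < b → suc j < a → r i (suc j) ≤P r i j
  decreasing-in-j i j i<b j+1<a =
    ≤P-from-C i (suc j) i j i<b j+1<a i<b (<-trans (n<1+n j) j+1<a)
      (map-upTo-pointwise _ _ n λ k _ → count≤-monoˡ-≤ (stride b n H i) (+-monoʳ-≤ (k * a) (n≤1+n j)))
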